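{- Let $A$ be a quantale with $Max(A)=\{m_1,\dots,m_n\}$ (the $m_i$ distinct). Then the quantales $[r(A))_A$ and $\prod_{i=1}^n[m_i)_A$ are isomorphic.
   Context: A quantale is a complete lattice $(A,\vee,\wedge,0,1)$ with an associative, commutative multiplication $\cdot$ with unit $1$ distributing over arbitrary joins. $Max(A)$ is the set of maximal elements of $A\setminus\{1\}$, $r(A)=\bigwedge Max(A)$. For $b\in A$, $[b)_A=\{x\in A:b\le x\}$ is a quantale with the lattice operations of $A$, bottom $b$, top $1$, multiplication $x\cdot_b y=(x\cdot y)\vee b$. Products carry componentwise operations. -}

module Defs where

open import Level using (Level; _⊔_; suc; Lift; lift)
open import Data.Bool using (Bool; true; false)
open import Data.Fin using (Fin)
open import Data.Product using (Σ; _,_; _×_; proj₁; proj₂; ∃)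
open import Data.Sum using (_⊎_)
open import Function using (_∘_)
open import Relation.Nullary using (¬_)
open import Relation.Binary.PropositionalEquality using (_≡_)
open import Relation.Binary.Structures using (IsEquivalence; IsPartialOrder)

record RawQuantale (c ℓ ι : Level) : Set (suc (c ⊔ ℓ ⊔ ι)) where
  infix  4 _≈_ _≤_
  infixl 7 _·_
  field
    Carrier : Set c
    _≈_     : Carrier → Carrier → Set ℓ
    _≤_     : Carrier → Carrier → Set ℓ
    ⋁       : {I : Set ι} → (I → Carrier) → Carrier
    _·_     : Carrier → Carrier → Carrier
    1#      : Carrier

-- A quantale: complete lattice (joins of all families indexed by types of
-- size c ⊔ ℓ, which includes all subsets of the carrier), with an
-- associative commutative multiplication with unit 1 = top, distributing
-- over arbitrary joins.
record Quantale (c ℓ : Level) : Set (suc (c ⊔ ℓ)) where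
  field
    raw : RawQuantale c ℓ (c ⊔ ℓ)
  open RawQuantale raw public
  field
    isPartialOrder : IsPartialOrder _≈_ _≤_
    ⋁-upper  : {I : Set (c ⊔ ℓ)} (f : I → Carrier) (i : I) → f i ≤ ⋁ f
    ⋁-least  : {I : Set (c ⊔ ℓ)} (f : I → Carrier) (u : Carrier) →
               ((i : I) → f i ≤ u) → ⋁ f ≤ u
    ·-cong   : ∀ {x x′ y y′} → x ≈ x′ → y ≈ y′ → x · y ≈ x′ · y′
    ·-assoc  : ∀ x y z → (x · y) · z ≈ x · (y · z)
    ·-comm   : ∀ x y → x · y ≈ y · x
    ·-identityˡ : ∀ x → 1# · x ≈ x
    1-top    : ∀ x → x ≤ 1#
    ·-distrib-⋁ : {I : Set (c ⊔ ℓ)} (x : Carrier) (f : I → Carrier) →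
                  x · ⋁ f ≈ ⋁ (λ i → x · f i)

module _ {c ℓ : Level} (A : Quantale c ℓ) where
  open Quantale A

  _∨_ : Carrier → Carrier → Carrier
  x ∨ y = ⋁ {I = Lift (c ⊔ ℓ) Bool} (λ { (lift true) → x ; (lift false) → y })

  ⋀ : {I : Set (c ⊔ ℓ)} → (I → Carrier) → Carrier
  ⋀ {I} f = ⋁ {I = Σ Carrier (λ y → (i : I) → y ≤ f i)} proj₁

  IsMax : Carrier → Set (c ⊔ ℓ)
  IsMax m = (¬ (m ≈ 1#)) × (∀ y → m ≤ y → (y ≈ m) ⊎ (y ≈ 1#))

  r : Carrier
  r = ⋀ {I = Σ Carrier IsMax} proj₁

  -- Up A b is the quantale [b)_A: elements x ≥ b, lattice operations of A
  -- (join of a family is b ∨ its join in A, so the empty join is b),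
  -- multiplication x ·_b y = (x · y) ∨ b, unit 1.
  Up : Carrier → RawQuantale (c ⊔ ℓ) ℓ (c ⊔ ℓ)
  Up b = record
    { Carrier = Σ Carrier (λ x → b ≤ x)
    ; _≈_ = λ x y → proj₁ x ≈ proj₁ y
    ; _≤_ = λ x y → proj₁ x ≤ proj₁ y
    ; ⋁ = λ f → (b ∨ ⋁ (proj₁ ∘ f)) ,
                ⋁-upper {I = Lift (c ⊔ ℓ) Bool} _ (lift true)
    ; _·_ = λ x y → ((proj₁ x · proj₁ y) ∨ b) ,
                ⋁-upper {I = Lift (c ⊔ ℓ) Bool} _ (lift false)
    ; 1# = 1# , 1-top b
    }

Π : {c ℓ ι : Level} {n : _} → (Fin n → RawQuantale c ℓ ι) → RawQuantale c ℓ ι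
Π {n = n} Q = record
  { Carrier = (i : Fin n) → RawQuantale.Carrier (Q i)
  ; _≈_ = λ x y → (i : Fin n) → RawQuantale._≈_ (Q i) (x i) (y i)
  ; _≤_ = λ x y → (i : Fin n) → RawQuantale._≤_ (Q i) (x i) (y i)
  ; ⋁ = λ f i → RawQuantale.⋁ (Q i) (λ k → f k i)
  ; _·_ = λ x y i → RawQuantale._·_ (Q i) (x i) (y i)
  ; 1# = λ i → RawQuantale.1# (Q i)
  }

record _≅_ {c ℓ ι : Level} (A B : RawQuantale c ℓ ι) : Set (c ⊔ ℓ ⊔ suc ι) where
  private
    module A = RawQuantale A
    module B = RawQuantale B
  field
    to       : A.Carrier → B.Carrier
    from     : B.Carrier → A.Carrier
    to-cong  : ∀ {x y} → x A.≈ y → to x B.≈ to y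
    from-cong : ∀ {x y} → x B.≈ y → from x A.≈ from y
    from∘to  : ∀ x → from (to x) A.≈ x
    to∘from  : ∀ y → to (from y) B.≈ y
    to-⋁     : {I : Set ι} (f : I → A.Carrier) → to (A.⋁ f) B.≈ B.⋁ (to ∘ f)
    to-·     : ∀ x y → to (x A.· y) B.≈ (to x B.· to y)
    to-1     : to A.1# B.≈ B.1#

-- Distinct maximal elements m, m′ are comaximal: m ∨ m′ is above m, hence is m or 1, and it
-- cannot be m since then m′ ≤ m. Since Max(A) is enumerated by m₁ … mₙ, r(A) is the finite meet
-- of the mᵢ, so the theorem is the Chinese remainder theorem for a pairwise comaximal family aᵢ,
-- which holds in every quantale whose unit is its top: x ↦ (x ∨ aᵢ)ᵢ is inverted by taking
-- the meet. Comaximality a ∨ w = 1 enters through y = y · (a ∨ w) = y · a ∨ y · w, where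
-- y · a ≤ a and y · w ≤ y ∧ w; this gives y ≤ a ∨ (y ∧ w) and (x ∨ a) ∧ (x ∨ w) ≤ x ∨ (a ∧ w),
-- the two inequalities behind the round trips.
module Submission where

open import Defs hiding (_∨_; ⋀)
import Defs
open import Level using (Level; _⊔_; Lift; lift)
open import Data.Bool using (Bool; true; false)
open import Data.Nat using (ℕ; zero; suc)
open import Data.Fin using (Fin; zero; suc; _≟_)
open import Data.Fin.Properties using (suc-injective)
open import Data.Product using (Σ; _,_; proj₁; proj₂)
open import Data.Sum using (inj₁; inj₂)
open import Function using (_∘_)
open import Relation.Nullary using (¬_; Dec; yes; no; contradiction)
open import Relation.Binary.Bundles using (Poset)
open import Relation.Binary.Structures using (IsPartialOrder)
open import Relation.Binary.PropositionalEquality using (_≡_; _≢_; refl)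

module Properties {c ℓ : Level} (A : Quantale c ℓ) where

  open Quantale A
  open IsPartialOrder isPartialOrder public
    using (antisym; module Eq)
    renaming (refl to ≤-refl; trans to ≤-trans; reflexive to ≤-reflexive)

  poset : Poset c ℓ ℓ
  poset = record { isPartialOrder = isPartialOrder }

  open import Relation.Binary.Reasoning.PartialOrder poset

  infixr 6 _∨_
  infixr 7 _∧_

  _∨_ : Carrier → Carrier → Carrier
  _∨_ = Defs._∨_ A

  ⋀ : {I : Set (c ⊔ ℓ)} → (I → Carrier) → Carrier
  ⋀ = Defs.⋀ A

  x≤x∨y : ∀ x y → x ≤ x ∨ y
  x≤x∨y x y = ⋁-upper _ (lift true)

  y≤x∨y : ∀ x y → y ≤ x ∨ y
  y≤x∨y x y = ⋁-upper _ (lift false)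

  ∨-least : ∀ {x y z} → x ≤ z → y ≤ z → x ∨ y ≤ z
  ∨-least x≤z y≤z = ⋁-least _ _ λ { (lift true) → x≤z ; (lift false) → y≤z }

  ∨-mono-≤ : ∀ {x y u v} → x ≤ u → y ≤ v → x ∨ y ≤ u ∨ v
  ∨-mono-≤ x≤u y≤v = ∨-least (≤-trans x≤u (x≤x∨y _ _)) (≤-trans y≤v (y≤x∨y _ _))

  ∨-cong : ∀ {x y u v} → x ≈ u → y ≈ v → x ∨ y ≈ u ∨ v
  ∨-cong x≈u y≈v = antisym (∨-mono-≤ (≤-reflexive x≈u) (≤-reflexive y≈v))
                           (∨-mono-≤ (≤-reflexive (Eq.sym x≈u)) (≤-reflexive (Eq.sym y≈v)))

  ∨-comm : ∀ x y → x ∨ y ≈ y ∨ x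
  ∨-comm x y = antisym (∨-least (y≤x∨y y x) (x≤x∨y y x)) (∨-least (y≤x∨y x y) (x≤x∨y x y))

  ∨-zeroˡ : ∀ x → 1# ∨ x ≈ 1#
  ∨-zeroˡ x = antisym (1-top _) (x≤x∨y 1# x)

  ⋀-lower : {I : Set (c ⊔ ℓ)} (f : I → Carrier) (i : I) → ⋀ f ≤ f i
  ⋀-lower f i = ⋁-least proj₁ (f i) (λ lb → proj₂ lb i)

  ⋀-greatest : {I : Set (c ⊔ ℓ)} (f : I → Carrier) {y : Carrier} → (∀ i → y ≤ f i) → y ≤ ⋀ f
  ⋀-greatest f {y} y≤f = ⋁-upper proj₁ (y , y≤f)

  _∧_ : Carrier → Carrier → Carrier
  x ∧ y = ⋀ {I = Lift (c ⊔ ℓ) Bool} λ { (lift true) → x ; (lift false) → y }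

  x∧y≤x : ∀ x y → x ∧ y ≤ x
  x∧y≤x x y = ⋀-lower _ (lift true)

  x∧y≤y : ∀ x y → x ∧ y ≤ y
  x∧y≤y x y = ⋀-lower _ (lift false)

  ∧-greatest : ∀ {x y z} → z ≤ x → z ≤ y → z ≤ x ∧ y
  ∧-greatest z≤x z≤y = ⋀-greatest _ λ { (lift true) → z≤x ; (lift false) → z≤y }

  ∧-mono-≤ : ∀ {x y u v} → x ≤ u → y ≤ v → x ∧ y ≤ u ∧ v
  ∧-mono-≤ x≤u y≤v = ∧-greatest (≤-trans (x∧y≤x _ _) x≤u) (≤-trans (x∧y≤y _ _) y≤v)

  ·-identityʳ : ∀ x → x · 1# ≈ x
  ·-identityʳ x = Eq.trans (·-comm x 1#) (·-identityˡ x)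

  ·-distribˡ-∨ : ∀ v x y → v · (x ∨ y) ≈ v · x ∨ v · y
  ·-distribˡ-∨ v x y = Eq.trans (·-distrib-⋁ v _) (antisym
    (⋁-least _ _ λ { (lift true) → x≤x∨y _ _ ; (lift false) → y≤x∨y _ _ })
    (∨-least (⋁-upper _ (lift true)) (⋁-upper _ (lift false))))

  ·-distribʳ-∨ : ∀ v x y → (x ∨ y) · v ≈ x · v ∨ y · v
  ·-distribʳ-∨ v x y = Eq.trans (·-comm _ v)
    (Eq.trans (·-distribˡ-∨ v x y) (∨-cong (·-comm v x) (·-comm v y)))

  ·-monoʳ-≤ : ∀ v {x y} → x ≤ y → v · x ≤ v · y
  ·-monoʳ-≤ v {x} {y} x≤y = begin
    v · x          ≤⟨ x≤x∨y _ _ ⟩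
    v · x ∨ v · y  ≈⟨ ·-distribˡ-∨ v x y ⟨
    v · (x ∨ y)    ≈⟨ ·-cong Eq.refl (antisym (∨-least x≤y ≤-refl) (y≤x∨y x y)) ⟩
    v · y          ∎

  ·-monoˡ-≤ : ∀ v {x y} → x ≤ y → x · v ≤ y · v
  ·-monoˡ-≤ v {x} {y} x≤y = begin
    x · v  ≈⟨ ·-comm x v ⟩
    v · x  ≤⟨ ·-monoʳ-≤ v x≤y ⟩
    v · y  ≈⟨ ·-comm v y ⟩
    y · v  ∎

  ·-mono-≤ : ∀ {x y u v} → x ≤ u → y ≤ v → x · y ≤ u · v
  ·-mono-≤ x≤u y≤v = ≤-trans (·-monoˡ-≤ _ x≤u) (·-monoʳ-≤ _ y≤v)

  x·y≤x : ∀ x y → x · y ≤ x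
  x·y≤x x y = begin
    x · y   ≤⟨ ·-monoʳ-≤ x (1-top y) ⟩
    x · 1#  ≈⟨ ·-identityʳ x ⟩
    x       ∎

  x·y≤y : ∀ x y → x · y ≤ y
  x·y≤y x y = ≤-trans (≤-reflexive (·-comm x y)) (x·y≤x y x)

  x·y≤x∧y : ∀ x y → x · y ≤ x ∧ y
  x·y≤x∧y x y = ∧-greatest (x·y≤x x y) (x·y≤y x y)

  ∨-·-∨≤∨-· : ∀ x u v → (x ∨ u) · v ≤ x ∨ u · v
  ∨-·-∨≤∨-· x u v = ≤-trans (≤-reflexive (·-distribʳ-∨ v x u)) (∨-mono-≤ (x·y≤x x v) ≤-refl)

  Comaximal : Carrier → Carrier → Set ℓ
  Comaximal a b = 1# ≤ a ∨ b

  comaximal⇒≤∨∧ : ∀ {a w} y → Comaximal a w → y ≤ a ∨ y ∧ w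
  comaximal⇒≤∨∧ {a} {w} y 1≤a∨w = begin
    y              ≈⟨ ·-identityʳ y ⟨
    y · 1#         ≤⟨ ·-monoʳ-≤ y 1≤a∨w ⟩
    y · (a ∨ w)    ≈⟨ ·-distribˡ-∨ y a w ⟩
    y · a ∨ y · w  ≤⟨ ∨-mono-≤ (x·y≤y y a) (x·y≤x∧y y w) ⟩
    a ∨ y ∧ w      ∎

  comaximal-∧ : ∀ {a b d} → Comaximal a b → Comaximal a d → Comaximal a (b ∧ d)
  comaximal-∧ {a} {b} {d} 1≤a∨b 1≤a∨d = begin
    1#         ≤⟨ 1≤a∨b ⟩
    a ∨ b      ≤⟨ ∨-least (x≤x∨y a _) (comaximal⇒≤∨∧ b 1≤a∨d) ⟩
    a ∨ b ∧ d  ∎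

  comaximal⇒∧-∨-distrib : ∀ x {a b} → Comaximal a b → (x ∨ a) ∧ (x ∨ b) ≤ x ∨ a ∧ b
  comaximal⇒∧-∨-distrib x {a} {b} 1≤a∨b = begin
    z              ≈⟨ ·-identityʳ z ⟨
    z · 1#         ≤⟨ ·-monoʳ-≤ z 1≤a∨b ⟩
    z · (a ∨ b)    ≈⟨ ·-distribˡ-∨ z a b ⟩
    z · a ∨ z · b  ≤⟨ ∨-least (absorb (x∧y≤y _ _) (≤-reflexive (·-comm b a)))
                              (absorb (x∧y≤x _ _) ≤-refl) ⟩
    x ∨ a ∧ b      ∎
    where
    z = (x ∨ a) ∧ (x ∨ b)
    absorb : ∀ {u v} → z ≤ x ∨ u → u · v ≤ a · b → z · v ≤ x ∨ a ∧ b
    absorb {u} {v} z≤x∨u uv≤ab = begin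
      z · v        ≤⟨ ·-monoˡ-≤ v z≤x∨u ⟩
      (x ∨ u) · v  ≤⟨ ∨-·-∨≤∨-· x u v ⟩
      x ∨ u · v    ≤⟨ ∨-mono-≤ ≤-refl (≤-trans uv≤ab (x·y≤x∧y a b)) ⟩
      x ∨ a ∧ b    ∎

  ⋀ᶠ : ∀ {n} → (Fin n → Carrier) → Carrier
  ⋀ᶠ {zero}  f = 1#
  ⋀ᶠ {suc n} f = f zero ∧ ⋀ᶠ (f ∘ suc)

  ⋀ᶠ-lower : ∀ {n} (f : Fin n → Carrier) i → ⋀ᶠ f ≤ f i
  ⋀ᶠ-lower f zero    = x∧y≤x _ _
  ⋀ᶠ-lower f (suc i) = ≤-trans (x∧y≤y _ _) (⋀ᶠ-lower (f ∘ suc) i)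

  ⋀ᶠ-greatest : ∀ {n} (f : Fin n → Carrier) {y} → (∀ i → y ≤ f i) → y ≤ ⋀ᶠ f
  ⋀ᶠ-greatest {zero}  f y≤f = 1-top _
  ⋀ᶠ-greatest {suc n} f y≤f = ∧-greatest (y≤f zero) (⋀ᶠ-greatest (f ∘ suc) (y≤f ∘ suc))

  ⋀ᶠ-mono-≤ : ∀ {n} {f g : Fin n → Carrier} → (∀ i → f i ≤ g i) → ⋀ᶠ f ≤ ⋀ᶠ g
  ⋀ᶠ-mono-≤ {f = f} f≤g = ⋀ᶠ-greatest _ λ i → ≤-trans (⋀ᶠ-lower f i) (f≤g i)

  ⋀ᶠ-cong : ∀ {n} {f g : Fin n → Carrier} → (∀ i → f i ≈ g i) → ⋀ᶠ f ≈ ⋀ᶠ g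
  ⋀ᶠ-cong f≈g = antisym (⋀ᶠ-mono-≤ (≤-reflexive ∘ f≈g)) (⋀ᶠ-mono-≤ (≤-reflexive ∘ Eq.sym ∘ f≈g))

  comaximal-⋀ᶠ : ∀ {n a} (f : Fin n → Carrier) → (∀ i → Comaximal a (f i)) → Comaximal a (⋀ᶠ f)
  comaximal-⋀ᶠ {zero}  f _   = y≤x∨y _ 1#
  comaximal-⋀ᶠ {suc n} f cmx = comaximal-∧ (cmx zero) (comaximal-⋀ᶠ (f ∘ suc) (cmx ∘ suc))

  PairwiseComaximal : ∀ {n} → (Fin n → Carrier) → Set ℓ
  PairwiseComaximal a = ∀ {i j} → i ≢ j → Comaximal (a i) (a j)

  ⋀ᶠ-∨-distrib : ∀ {n} x (a : Fin n → Carrier) → PairwiseComaximal a →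
                 ⋀ᶠ (λ i → x ∨ a i) ≤ x ∨ ⋀ᶠ a
  ⋀ᶠ-∨-distrib {zero}  x a _   = y≤x∨y x 1#
  ⋀ᶠ-∨-distrib {suc n} x a pcm = begin
    (x ∨ a zero) ∧ ⋀ᶠ (λ i → x ∨ a (suc i))
      ≤⟨ ∧-mono-≤ ≤-refl (⋀ᶠ-∨-distrib x (a ∘ suc) (λ i≢j → pcm (i≢j ∘ suc-injective))) ⟩
    (x ∨ a zero) ∧ (x ∨ ⋀ᶠ (a ∘ suc))
      ≤⟨ comaximal⇒∧-∨-distrib x (comaximal-⋀ᶠ (a ∘ suc) (λ i → pcm λ ())) ⟩
    x ∨ a zero ∧ ⋀ᶠ (a ∘ suc)
      ∎

  ≤∨⋀ᶠ : ∀ {n} {a y : Fin n → Carrier} → PairwiseComaximal a → (∀ j → a j ≤ y j) →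
         ∀ i → y i ≤ a i ∨ ⋀ᶠ y
  ≤∨⋀ᶠ {n} {a} {y} pcm a≤y i = begin
    y i
      ≤⟨ comaximal⇒≤∨∧ (y i) (comaximal-⋀ᶠ cofactors λ j → cover j (i ≟ j)) ⟩
    a i ∨ y i ∧ ⋀ᶠ cofactors
      ≤⟨ ∨-mono-≤ ≤-refl (⋀ᶠ-greatest y λ j → below j (i ≟ j) (⋀ᶠ-lower cofactors j)) ⟩
    a i ∨ ⋀ᶠ y
      ∎
    where
    -- y with its i-th entry replaced by 1: every entry is then comaximal with a i.
    cofactor : ∀ j → Dec (i ≡ j) → Carrier
    cofactor j (yes _) = 1#
    cofactor j (no _)  = y j
    cofactors : Fin n → Carrier
    cofactors j = cofactor j (i ≟ j)
    cover : ∀ j d → Comaximal (a i) (cofactor j d)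
    cover j (yes _)  = y≤x∨y _ 1#
    cover j (no i≢j) = ≤-trans (pcm i≢j) (∨-mono-≤ ≤-refl (a≤y j))
    below : ∀ j d → ⋀ᶠ cofactors ≤ cofactor j d → y i ∧ ⋀ᶠ cofactors ≤ y j
    below j (yes refl) _ = x∧y≤x _ _
    below j (no _)     p = ≤-trans (x∧y≤y _ _) p

  ∨-homo-⋁ : ∀ {a b} {I : Set (c ⊔ ℓ)} (f : I → Carrier) → b ≤ a →
        (b ∨ ⋁ f) ∨ a ≈ a ∨ ⋁ (λ k → f k ∨ a)
  ∨-homo-⋁ {a} f b≤a = antisym
    (∨-least (∨-least (≤-trans b≤a (x≤x∨y a _)) (⋁-least f _ λ k → begin
        f k                  ≤⟨ x≤x∨y (f k) a ⟩
        f k ∨ a              ≤⟨ ⋁-upper (λ k → f k ∨ a) k ⟩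
        ⋁ (λ k → f k ∨ a)    ≤⟨ y≤x∨y a _ ⟩
        a ∨ ⋁ (λ k → f k ∨ a)  ∎))
      (x≤x∨y a _))
    (∨-least (y≤x∨y _ a) (⋁-least _ _ λ k → ∨-mono-≤ (≤-trans (⋁-upper f k) (y≤x∨y _ _)) ≤-refl))

  ∨-homo-· : ∀ {a b} x y → b ≤ a → (x · y ∨ b) ∨ a ≈ (x ∨ a) · (y ∨ a) ∨ a
  ∨-homo-· {a} {b} x y b≤a = antisym
    (∨-least (∨-least (≤-trans (·-mono-≤ (x≤x∨y x a) (x≤x∨y y a)) (x≤x∨y _ a))
                      (≤-trans b≤a (y≤x∨y _ a)))
             (y≤x∨y _ a))
    (∨-least (begin
      (x ∨ a) · (y ∨ a)              ≈⟨ ·-distribʳ-∨ (y ∨ a) x a ⟩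
      x · (y ∨ a) ∨ a · (y ∨ a)      ≈⟨ ∨-cong (·-distribˡ-∨ x y a) Eq.refl ⟩
      (x · y ∨ x · a) ∨ a · (y ∨ a)  ≤⟨ ∨-least (∨-mono-≤ ≤-refl (x·y≤y x a))
                                                (≤-trans (x·y≤x a _) (y≤x∨y _ a)) ⟩
      x · y ∨ a                      ≤⟨ ∨-mono-≤ (x≤x∨y _ b) ≤-refl ⟩
      (x · y ∨ b) ∨ a                ∎)
      (y≤x∨y _ a))

  crt : ∀ {n} (a : Fin n → Carrier) (b : Carrier) → PairwiseComaximal a →
        (∀ i → b ≤ a i) → ⋀ᶠ a ≤ b → Up A b ≅ Π (λ i → Up A (a i))
  crt a b pcm b≤a ⋀a≤b = record
    { to        = λ x i → proj₁ x ∨ a i , y≤x∨y _ _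
    ; from      = λ y → ⋀ᶠ (proj₁ ∘ y) , ⋀ᶠ-greatest _ λ i → ≤-trans (b≤a i) (proj₂ (y i))
    ; to-cong   = λ x≈y i → ∨-cong x≈y Eq.refl
    ; from-cong = ⋀ᶠ-cong
    ; from∘to   = λ x → antisym
        (≤-trans (⋀ᶠ-∨-distrib (proj₁ x) a pcm) (∨-least ≤-refl (≤-trans ⋀a≤b (proj₂ x))))
        (⋀ᶠ-greatest (λ i → proj₁ x ∨ a i) λ i → x≤x∨y _ _)
    ; to∘from   = λ y i → antisym
        (∨-least (⋀ᶠ-lower _ i) (proj₂ (y i)))
        (≤-trans (≤∨⋀ᶠ pcm (proj₂ ∘ y) i) (≤-reflexive (∨-comm _ _)))
    ; to-⋁      = λ f i → ∨-homo-⋁ (proj₁ ∘ f) (b≤a i)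
    ; to-·      = λ x y i → ∨-homo-· (proj₁ x) (proj₁ y) (b≤a i)
    ; to-1      = λ i → ∨-zeroˡ (a i)
    }

  distinct-max-comaximal : ∀ {m m′} → IsMax A m → IsMax A m′ → ¬ m ≈ m′ → Comaximal m m′
  distinct-max-comaximal {m} {m′} (m≉1 , m-max) (_ , m′-max) m≉m′
    with m-max (m ∨ m′) (x≤x∨y m m′)
  ... | inj₂ m∨m′≈1 = ≤-reflexive (Eq.sym m∨m′≈1)
  ... | inj₁ m∨m′≈m with m′-max m (≤-trans (y≤x∨y m m′) (≤-reflexive m∨m′≈m))
  ...   | inj₁ m≈m′ = contradiction m≈m′ m≉m′
  ...   | inj₂ m≈1  = contradiction m≈1 m≉1

  r≤max : ∀ {m} → IsMax A m → r A ≤ m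
  r≤max {m} m-max = ⋀-lower proj₁ (m , m-max)

  r-greatest : ∀ {y} → (∀ m → IsMax A m → y ≤ m) → y ≤ r A
  r-greatest y≤max = ⋀-greatest proj₁ λ { (m , m-max) → y≤max m m-max }

proposition7p6 : {c ℓ : Level} (A : Quantale c ℓ) (n : ℕ) (m : Fin n → Quantale.Carrier A)
    → (∀ i j → Quantale._≈_ A (m i) (m j) → i ≡ j)
    → (∀ i → IsMax A (m i))
    → (∀ x → IsMax A x → Σ (Fin n) (λ i → Quantale._≈_ A x (m i)))
    → Up A (r A) ≅ Π (λ i → Up A (m i))
proposition7p6 A n m m-injective m-max m-surjective =
  crt m (r A) pairwise-comaximal (λ i → r≤max (m-max i)) ⋀m≤r
  where
  open Quantale A using (_≤_)
  open Properties A
  pairwise-comaximal : PairwiseComaximal m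
  pairwise-comaximal {i} {j} i≢j =
    distinct-max-comaximal (m-max i) (m-max j) (i≢j ∘ m-injective i j)
  ⋀m≤r : ⋀ᶠ m ≤ r A
  ⋀m≤r = r-greatest λ x x-max →
    let (i , x≈mᵢ) = m-surjective x x-max
    in ≤-trans (⋀ᶠ-lower m i) (≤-reflexive (Eq.sym x≈mᵢ))
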